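{- Let $X$ be a sentence of the language of $\mathbf{CLA4}$, $\mathcal X$ an HPM that solves $X^\dagger$ and runs in time $\chi$, where $\chi$ is a single-variable term of the language of $\mathbf{PA}$ with $\chi(x)\ge x$ for all $x$, and let $\mathbb{L}$ be the sentence defined below. For any formula $E$ that is a subformula of $X$ (possibly with some variables renamed), including $X$ itself, let $\overline{E}$ be the result of replacing in $E$ every politeral $L$ by $L\vee\mathbb{L}$. Then $E^\dagger=\overline{E}^\dagger$ (as games, under the standard interpretation).
   Context: Language of $\mathbf{CLA4}$: terms built from variables, $0$, $'$, $+$, $\times$; atoms $\tau_1=\tau_2$; formulas built with $\top,\bot,\neg$ (on atoms; elsewhere via De Morgan), $\wedge,\vee,\sqcap,\sqcup$, quantifiers $\forall,\exists,\sqcap x,\sqcup x$. Elementary formulas (no $\sqcap,\sqcup$) are those of $\mathbf{PA}$. A literal is $\top$, $\bot$, or an atomic formula with or without $\neg$; a politeral of a formula is a positive occurrence (not in the scope of $\neg$) of a literal in it. The elementarization $\|F\|$ of $F$ replaces every $\sqcup$- and $\sqcup x$-subformula by $\bot$ and every $\sqcap$- and $\sqcap x$-subformula by $\top$. Games and machines. Each formula $F$ denotes under the standard interpretation $\dagger$ (universe $\mathbb N$, standard $'$, $+$, $\times$) a game $F^\dagger$ (depending on the values of its free variables) between machine $\top$ and environment $\bot$: elementary formulas are moveless and won by $\top$ iff true; $\neg$ swaps roles; in $A_0\sqcap A_1$ (resp. $A_0\sqcup A_1$) $\bot$ (resp. $\top$) chooses $i\in\{0,1\}$ and play continues as $A_i$,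 the player who should choose losing if it never does; $\sqcap xA(x)$, $\sqcup xA(x)$ are the infinite $\sqcap$/$\sqcup$ over $A(0),A(1),\ldots$; $A_0\wedge A_1$, $A_0\vee A_1$ play components in parallel (moves $i.\alpha$), $\top$ winning iff it wins both / at least one; $\forall xA(x)$ ($\exists$ dual) has the moves of $A(x)$ and is won by $\top$ iff the run is won in $A(c)$ for every $c$; the first player to make an illegal move loses. $\langle\Gamma\rangle A$ is the game to which $A$ evolves after the legal run $\Gamma$. An HPM is a Turing machine with a work tape and a read-only run tape spelling the current position; entering a move state makes the work-tape contents left of the head a $\top$-move; the environment may append $\bot$-moves on any cycle. It solves $A$ iff every run it generates is $\top$-won. The background of a cycle is the maximal size of environment moves so far ($0$ if none); the timecost of a move at cycle $c$ is $c-d$, $d$ the latest earlier cycle with a move by either player ($0$ if none); the machine runs in time $h$ iff every move it makes has timecost and size at most $h(\ell)$, $\ell$ the background. The sentence $\mathbb L$. Let $E_1(\vec x),\ldots,E_n(\vec x)$ be all subformulas of $X$, with all their free variables among $\vec x$. $\mathbb{L}$ is the $\vee$-disjunction of natural $\mathbf{PA}$-formalizations (via Gödel arithmetization) of: (1) on some clock cycle of some computation branch of $\mathcal X$ the run tape spells a $\top$-illegal position of $X$; (2) on some cycle $c$ of some computation branch, $\mathcal X$ makes a move whose timecost exceeds $\chi(\ell)$, $\ell$ the background of $c$; (3) there are a finite legal run $\Gamma$ of $X$ generated by $\mathcal X$, constants $\vec c$, and $i$ with $\langle\Gamma\rangle X=E_i(\vec c)$ and $\|E_i(\vec c)\|$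 false. -}

module Defs where

open import Data.Nat using (ℕ; zero; suc; _+_; _*_; _∸_; _≤_; _<_; _≡ᵇ_; _<ᵇ_)
  renaming (_⊔_ to max)
open import Data.Nat.DivMod using (_/_; _%_)
open import Data.Fin using (Fin; zero; suc)
open import Data.Bool using (Bool; true; false; if_then_else_; not; _∨_)
open import Data.List using (List; []; _∷_; _++_; map; length; reverse; foldr; concatMap; mapMaybe; upTo; null)
open import Data.List.Relation.Unary.All using (All)
open import Data.Maybe using (Maybe; just; nothing; maybe; is-just)
import Data.Maybe as M
open import Data.Product using (Σ; _×_; _,_; proj₁; proj₂)
open import Data.Sum using (_⊎_)
open import Data.Unit using (⊤)
open import Data.Empty using (⊥)
open import Relation.Nullary using (¬_)
open import Relation.Binary.PropositionalEquality using (_≡_; _≢_)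
open import Function.Bundles using (_⇔_)

-- Syntax of CLA4 (negation normal form; ¬ only on atoms)

Var : Set
Var = ℕ

data Term : Set where
  v   : Var → Term
  𝟎   : Term
  S   : Term → Term
  _⊕_ : Term → Term → Term
  _⊗_ : Term → Term → Term

data Formula : Set where
  ⊤′ ⊥′     : Formula
  _==_      : Term → Term → Formula
  _=/=_     : Term → Term → Formula
  _∧′_ _∨′_ : Formula → Formula → Formula
  _⊓′_ _⊔′_ : Formula → Formula → Formula
  ∀′ ∃′     : Var → Formula → Formula      -- blind quantifiers
  ⊓∀ ⊔∃     : Var → Formula → Formula

OccT : Var → Term → Set
OccT y (v x) = y ≡ x
OccT y 𝟎 = ⊥
OccT y (S t) = OccT y t
OccT y (t ⊕ u) = OccT y t ⊎ OccT y u
OccT y (t ⊗ u) = OccT y t ⊎ OccT y u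

FreeIn : Var → Formula → Set
FreeIn y ⊤′ = ⊥
FreeIn y ⊥′ = ⊥
FreeIn y (t == u) = OccT y t ⊎ OccT y u
FreeIn y (t =/= u) = OccT y t ⊎ OccT y u
FreeIn y (A ∧′ B) = FreeIn y A ⊎ FreeIn y B
FreeIn y (A ∨′ B) = FreeIn y A ⊎ FreeIn y B
FreeIn y (A ⊓′ B) = FreeIn y A ⊎ FreeIn y B
FreeIn y (A ⊔′ B) = FreeIn y A ⊎ FreeIn y B
FreeIn y (∀′ x A) = (y ≢ x) × FreeIn y A
FreeIn y (∃′ x A) = (y ≢ x) × FreeIn y A
FreeIn y (⊓∀ x A) = (y ≢ x) × FreeIn y A
FreeIn y (⊔∃ x A) = (y ≢ x) × FreeIn y A

Sentence : Formula → Set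
Sentence F = (y : Var) → ¬ FreeIn y F

Elementary : Formula → Set
Elementary ⊤′ = ⊤
Elementary ⊥′ = ⊤
Elementary (t == u) = ⊤
Elementary (t =/= u) = ⊤
Elementary (A ∧′ B) = Elementary A × Elementary B
Elementary (A ∨′ B) = Elementary A × Elementary B
Elementary (A ⊓′ B) = ⊥
Elementary (A ⊔′ B) = ⊥
Elementary (∀′ x A) = Elementary A
Elementary (∃′ x A) = Elementary A
Elementary (⊓∀ x A) = ⊥
Elementary (⊔∃ x A) = ⊥

data Sub (E : Formula) : Formula → Set where
  here : Sub E E
  ∧l : ∀ {A B} → Sub E A → Sub E (A ∧′ B)
  ∧r : ∀ {A B} → Sub E B → Sub E (A ∧′ B)
  ∨l : ∀ {A B} → Sub E A → Sub E (A ∨′ B)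
  ∨r : ∀ {A B} → Sub E B → Sub E (A ∨′ B)
  ⊓l : ∀ {A B} → Sub E A → Sub E (A ⊓′ B)
  ⊓r : ∀ {A B} → Sub E B → Sub E (A ⊓′ B)
  ⊔l : ∀ {A B} → Sub E A → Sub E (A ⊔′ B)
  ⊔r : ∀ {A B} → Sub E B → Sub E (A ⊔′ B)
  in∀ : ∀ {x A} → Sub E A → Sub E (∀′ x A)
  in∃ : ∀ {x A} → Sub E A → Sub E (∃′ x A)
  in⊓∀ : ∀ {x A} → Sub E A → Sub E (⊓∀ x A)
  in⊔∃ : ∀ {x A} → Sub E A → Sub E (⊔∃ x A)

renT : (Var → Var) → Term → Term
renT r (v x) = v (r x)
renT r 𝟎 = 𝟎
renT r (S t) = S (renT r t)
renT r (t ⊕ u) = renT r t ⊕ renT r u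
renT r (t ⊗ u) = renT r t ⊗ renT r u

rename : (Var → Var) → Formula → Formula
rename r ⊤′ = ⊤′
rename r ⊥′ = ⊥′
rename r (t == u) = renT r t == renT r u
rename r (t =/= u) = renT r t =/= renT r u
rename r (A ∧′ B) = rename r A ∧′ rename r B
rename r (A ∨′ B) = rename r A ∨′ rename r B
rename r (A ⊓′ B) = rename r A ⊓′ rename r B
rename r (A ⊔′ B) = rename r A ⊔′ rename r B
rename r (∀′ x A) = ∀′ (r x) (rename r A)
rename r (∃′ x A) = ∃′ (r x) (rename r A)
rename r (⊓∀ x A) = ⊓∀ (r x) (rename r A)
rename r (⊔∃ x A) = ⊔∃ (r x) (rename r A)

SubUpToRenaming : Formula → Formula → Set
SubUpToRenaming E X = Σ Formula λ F → Sub F X × Σ (Var → Var) λ r → E ≡ rename r F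

elem : Formula → Formula
elem (A ∧′ B) = elem A ∧′ elem B
elem (A ∨′ B) = elem A ∨′ elem B
elem (A ⊓′ B) = ⊤′
elem (A ⊔′ B) = ⊥′
elem (∀′ x A) = ∀′ x (elem A)
elem (∃′ x A) = ∃′ x (elem A)
elem (⊓∀ x A) = ⊤′
elem (⊔∃ x A) = ⊥′
elem L = L

-- Ē : replace every politeral L (every literal occurrence, the formula
-- being in negation normal form) by L ∨ 𝕃
bar : Formula → Formula → Formula
bar 𝕃 (A ∧′ B) = bar 𝕃 A ∧′ bar 𝕃 B
bar 𝕃 (A ∨′ B) = bar 𝕃 A ∨′ bar 𝕃 B
bar 𝕃 (A ⊓′ B) = bar 𝕃 A ⊓′ bar 𝕃 B
bar 𝕃 (A ⊔′ B) = bar 𝕃 A ⊔′ bar 𝕃 B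
bar 𝕃 (∀′ x A) = ∀′ x (bar 𝕃 A)
bar 𝕃 (∃′ x A) = ∃′ x (bar 𝕃 A)
bar 𝕃 (⊓∀ x A) = ⊓∀ x (bar 𝕃 A)
bar 𝕃 (⊔∃ x A) = ⊔∃ x (bar 𝕃 A)
bar 𝕃 L = L ∨′ 𝕃

Val : Set
Val = Var → ℕ

upd : Val → Var → ℕ → Val
upd ρ x c y = if y ≡ᵇ x then c else ρ y

evalT : Term → Val → ℕ
evalT (v x) ρ = ρ x
evalT 𝟎 ρ = 0
evalT (S t) ρ = suc (evalT t ρ)
evalT (t ⊕ u) ρ = evalT t ρ + evalT u ρ
evalT (t ⊗ u) ρ = evalT t ρ * evalT u ρ

-- Tarskian truth in the standard model (used for elementary formulas;
-- choice operators are read as in the elementarization)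
Truth : Formula → Val → Set
Truth ⊤′ ρ = ⊤
Truth ⊥′ ρ = ⊥
Truth (t == u) ρ = evalT t ρ ≡ evalT u ρ
Truth (t =/= u) ρ = evalT t ρ ≢ evalT u ρ
Truth (A ∧′ B) ρ = Truth A ρ × Truth B ρ
Truth (A ∨′ B) ρ = Truth A ρ ⊎ Truth B ρ
Truth (A ⊓′ B) ρ = ⊤
Truth (A ⊔′ B) ρ = ⊥
Truth (∀′ x A) ρ = (c : ℕ) → Truth A (upd ρ x c)
Truth (∃′ x A) ρ = Σ ℕ λ c → Truth A (upd ρ x c)
Truth (⊓∀ x A) ρ = ⊤
Truth (⊔∃ x A) ρ = ⊥

-- keyboard alphabet (binary digits suffice; we allow decimal digits, '.', blank)
data Sym : Set where
  dig   : Fin 10 → Sym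
  dot   : Sym
  blank : Sym

data Player : Set where
  top bot : Player

Move : Set
Move = List Sym

LMove : Set
LMove = Player × Move

Position : Set
Position = List LMove

-- a (possibly infinite) run, given as a sequence of finite chunks;
-- the run is the concatenation of all chunks
Run : Set
Run = ℕ → List LMove

pre : Run → ℕ → Position
pre Γ zero = []
pre Γ (suc t) = pre Γ t ++ Γ t

_⊹_ : Position → Run → Run
(Φ ⊹ Δ) zero = Φ ++ Δ zero
(Φ ⊹ Δ) (suc t) = Δ (suc t)

private
  bitOf : ℕ → Sym
  bitOf k = if k ≡ᵇ 0 then dig zero else dig (suc zero)
  bitsLE : ℕ → ℕ → List Sym
  bitsLE zero n = []
  bitsLE (suc f) zero = []
  bitsLE (suc f) (suc n) = bitOf (suc n % 2) ∷ bitsLE f (suc n / 2)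

numeral : ℕ → Move
numeral zero = dig zero ∷ []
numeral (suc n) = reverse (bitsLE (suc n) (suc n))

choice : Bool → Move
choice false = dig zero ∷ []
choice true = dig (suc zero) ∷ []

strip : Bool → Move → Maybe Move
strip false (dig zero ∷ dot ∷ β) = just β
strip true (dig (suc zero) ∷ dot ∷ β) = just β
strip _ _ = nothing

proj : Bool → Position → Position
proj i = mapMaybe (λ m → M.map (λ β → proj₁ m , β) (strip i (proj₂ m)))

projR : Bool → Run → Run
projR i Γ t = proj i (Γ t)

ParMove : LMove → Set
ParMove m = (is-just (strip false (proj₂ m)) ≡ true) ⊎ (is-just (strip true (proj₂ m)) ≡ true)

FirstAt : Run → ℕ → LMove → List LMove → Set
FirstAt Γ t m rest = ((s : ℕ) → s < t → Γ s ≡ []) × (Γ t ≡ m ∷ rest)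

after : Run → ℕ → List LMove → Run
after Γ t rest s = if s <ᵇ t then [] else (if s ≡ᵇ t then rest else Γ s)

EmptyRun : Run → Set
EmptyRun Γ = (t : ℕ) → Γ t ≡ []

record Game : Set₁ where
  field
    Lr : Position → Set
    Wn : Run → Set

open Game public

LegalRun : Game → Run → Set
LegalRun G Γ = (t : ℕ) → Lr G (pre Γ t)

IllegalBy : Player → Game → Position → Set
IllegalBy p G Φ = Σ Position λ Ψ → Σ LMove λ m → Σ Position λ rest →
  (Φ ≡ Ψ ++ (m ∷ rest)) × Lr G Ψ × ¬ Lr G (Ψ ++ (m ∷ [])) × (proj₁ m ≡ p)

TopWins : Game → Run → Set
TopWins G Γ = (LegalRun G Γ × Wn G Γ) ⊎ (Σ ℕ λ t → IllegalBy bot G (pre Γ t))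

GameEq : Game → Game → Set
GameEq G H = ((Φ : Position) → Lr G Φ ⇔ Lr H Φ)
           × ((Γ : Run) → LegalRun H Γ → Wn G Γ ⇔ Wn H Γ)

evolve : Position → Game → Game
evolve Φ G = record { Lr = λ Ψ → Lr G (Φ ++ Ψ) ; Wn = λ Δ → Wn G (Φ ⊹ Δ) }

LegalF : Formula → Val → Position → Set
LegalF (A ∧′ B) ρ Φ = All ParMove Φ × LegalF A ρ (proj false Φ) × LegalF B ρ (proj true Φ)
LegalF (A ∨′ B) ρ Φ = All ParMove Φ × LegalF A ρ (proj false Φ) × LegalF B ρ (proj true Φ)
LegalF (A ⊓′ B) ρ Φ = (Φ ≡ []) ⊎ (Σ Position λ Ψ →
  ((Φ ≡ (bot , choice false) ∷ Ψ) × LegalF A ρ Ψ) ⊎ ((Φ ≡ (bot , choice true) ∷ Ψ) × LegalF B ρ Ψ))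
LegalF (A ⊔′ B) ρ Φ = (Φ ≡ []) ⊎ (Σ Position λ Ψ →
  ((Φ ≡ (top , choice false) ∷ Ψ) × LegalF A ρ Ψ) ⊎ ((Φ ≡ (top , choice true) ∷ Ψ) × LegalF B ρ Ψ))
LegalF (∀′ x A) ρ Φ = (c : ℕ) → LegalF A (upd ρ x c) Φ
LegalF (∃′ x A) ρ Φ = (c : ℕ) → LegalF A (upd ρ x c) Φ
LegalF (⊓∀ x A) ρ Φ = (Φ ≡ []) ⊎ (Σ ℕ λ c → Σ Position λ Ψ →
  (Φ ≡ (bot , numeral c) ∷ Ψ) × LegalF A (upd ρ x c) Ψ)
LegalF (⊔∃ x A) ρ Φ = (Φ ≡ []) ⊎ (Σ ℕ λ c → Σ Position λ Ψ →
  (Φ ≡ (top , numeral c) ∷ Ψ) × LegalF A (upd ρ x c) Ψ)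
LegalF L ρ Φ = Φ ≡ []

WinF : Formula → Val → Run → Set
WinF (A ∧′ B) ρ Γ = WinF A ρ (projR false Γ) × WinF B ρ (projR true Γ)
WinF (A ∨′ B) ρ Γ = WinF A ρ (projR false Γ) ⊎ WinF B ρ (projR true Γ)
WinF (A ⊓′ B) ρ Γ = EmptyRun Γ ⊎ (Σ ℕ λ t → Σ (List LMove) λ rest →
  (FirstAt Γ t (bot , choice false) rest × WinF A ρ (after Γ t rest))
  ⊎ (FirstAt Γ t (bot , choice true) rest × WinF B ρ (after Γ t rest)))
WinF (A ⊔′ B) ρ Γ = Σ ℕ λ t → Σ (List LMove) λ rest →
  (FirstAt Γ t (top , choice false) rest × WinF A ρ (after Γ t rest))
  ⊎ (FirstAt Γ t (top , choice true) rest × WinF B ρ (after Γ t rest))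
WinF (∀′ x A) ρ Γ = (c : ℕ) → WinF A (upd ρ x c) Γ
WinF (∃′ x A) ρ Γ = Σ ℕ λ c → WinF A (upd ρ x c) Γ
WinF (⊓∀ x A) ρ Γ = EmptyRun Γ ⊎ (Σ ℕ λ c → Σ ℕ λ t → Σ (List LMove) λ rest →
  FirstAt Γ t (bot , numeral c) rest × WinF A (upd ρ x c) (after Γ t rest))
WinF (⊔∃ x A) ρ Γ = Σ ℕ λ c → Σ ℕ λ t → Σ (List LMove) λ rest →
  FirstAt Γ t (top , numeral c) rest × WinF A (upd ρ x c) (after Γ t rest)
WinF L ρ Γ = Truth L ρ

⟦_⟧ : Formula → Val → Game
⟦ F ⟧ ρ = record { Lr = LegalF F ρ ; Wn = WinF F ρ }

ρ₀ : Val
ρ₀ _ = 0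

data Dir : Set where
  left stay right : Dir

data RChar : Set where
  lab : Player → RChar
  ch  : Sym → RChar

rstring : Position → List RChar
rstring = concatMap (λ m → lab (proj₁ m) ∷ map ch (proj₂ m))

nth : {A : Set} → List A → ℕ → Maybe A
nth [] _ = nothing
nth (a ∷ as) zero = just a
nth (a ∷ as) (suc i) = nth as i

moveHead : Dir → ℕ → ℕ
moveHead left h = h ∸ 1
moveHead stay h = h
moveHead right h = suc h

record HPM : Set where
  field
    nS     : ℕ
    start  : Fin nS
    isMove : Fin nS → Bool
    -- (state, work-tape symbol, run-tape symbol (nothing = blank)) ↦
    -- (new state, symbol written, work-head move, run-head move)
    δ      : Fin nS → Sym → Maybe RChar → Fin nS × Sym × Dir × Dir

record Cfg (M : HPM) : Set where
  field
    st   : Fin (HPM.nS M)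
    tape : ℕ → Sym
    wh   : ℕ
    rh   : ℕ

initCfg : (M : HPM) → Cfg M
initCfg M = record { st = HPM.start M ; tape = λ _ → blank ; wh = 0 ; rh = 0 }

topMove : (M : HPM) → Cfg M → Maybe Move
topMove M C = if HPM.isMove M (Cfg.st C)
  then just (map (Cfg.tape C) (upTo (Cfg.wh C))) else nothing

step : (M : HPM) → Cfg M → Position → Cfg M
step M C P with HPM.δ M (Cfg.st C) (Cfg.tape C (Cfg.wh C)) (nth (rstring P) (Cfg.rh C))
... | q , s , dw , dr = record
  { st = q
  ; tape = λ y → if y ≡ᵇ Cfg.wh C then s else Cfg.tape C y
  ; wh = moveHead dw (Cfg.wh C)
  ; rh = moveHead dr (Cfg.rh C) }

-- behaviour of the environment on a computation branch:
-- the (finitely many) moves it makes on each cycle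
Env : Set
Env = ℕ → List Move

envCh : Env → ℕ → List LMove
envCh e t = map (λ α → bot , α) (e t)

topCh : (M : HPM) → Cfg M → List LMove
topCh M C = maybe (λ α → (top , α) ∷ []) [] (topMove M C)

-- configuration on cycle t, and moves made before cycle t
hist : (M : HPM) → Env → ℕ → Cfg M × Position
hist M e zero = initCfg M , []
hist M e (suc t) with hist M e t
... | C , H = step M C (H ++ envCh e t) , (H ++ envCh e t) ++ topCh M C

cfgAt : (M : HPM) → Env → ℕ → Cfg M
cfgAt M e t = proj₁ (hist M e t)

posAt : (M : HPM) → Env → ℕ → Position
posAt M e t = proj₂ (hist M e t) ++ envCh e t

runOf : (M : HPM) → Env → Run
runOf M e t = envCh e t ++ topCh M (cfgAt M e t)

maxLen : List Move → ℕ
maxLen = foldr (λ α m → max (length α) m) 0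

background : Env → ℕ → ℕ
background e zero = maxLen (e zero)
background e (suc c) = max (background e c) (maxLen (e (suc c)))

moved : (M : HPM) → Env → ℕ → Bool
moved M e s = not (null (e s)) ∨ is-just (topMove M (cfgAt M e s))

-- latest cycle < c on which a move was made (0 if none)
lastBefore : (M : HPM) → Env → ℕ → ℕ
lastBefore M e zero = 0
lastBefore M e (suc c) = if moved M e c then c else lastBefore M e c

timecost : (M : HPM) → Env → ℕ → ℕ
timecost M e c = c ∸ lastBefore M e c

Solves : HPM → Game → Set
Solves M G = (e : Env) → TopWins G (runOf M e)

RunsInTime : HPM → (ℕ → ℕ) → Set
RunsInTime M h = (e : Env) (c : ℕ) (α : Move) → topMove M (cfgAt M e c) ≡ just α →
  (timecost M e c ≤ h (background e c)) × (length α ≤ h (background e c))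

-- The three disjuncts of 𝕃 (for X, 𝒳, χ)

Cond1 : Formula → HPM → Set
Cond1 X M = Σ Env λ e → Σ ℕ λ c → IllegalBy top (⟦ X ⟧ ρ₀) (posAt M e c)

Cond2 : Formula → HPM → (ℕ → ℕ) → Set
Cond2 X M χ = Σ Env λ e → Σ ℕ λ c → Σ Move λ α →
  (topMove M (cfgAt M e c) ≡ just α) × (χ (background e c) < timecost M e c)

GeneratesFinite : HPM → Position → Set
GeneratesFinite M Γ = Σ Env λ e → Σ ℕ λ T → (t : ℕ) → T ≤ t → posAt M e t ≡ Γ

Cond3 : Formula → HPM → Set
Cond3 X M = Σ Position λ Γ → LegalF X ρ₀ Γ × GeneratesFinite M Γ ×
  (Σ Formula λ E → Sub E X × Σ Val λ σ →
     GameEq (evolve Γ (⟦ X ⟧ ρ₀)) (⟦ E ⟧ σ) × ¬ Truth (elem E) σ)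

SingleVar : Term → Set
SingleVar χ = (y z : Var) → OccT y χ → OccT z χ → y ≡ z

evalχ : Term → ℕ → ℕ
evalχ χ n = evalT χ (λ _ → n)

-- Under the hypotheses 𝕃 is false. Disjunct (2) contradicts the time bound.
-- Disjunct (1) fails because every run 𝒳 generates is won by 𝒳, so its first
-- illegal move, if any, is the environment's, while the run tape always spells
-- a prefix of that run. Disjunct (3) fails because a run of 𝒳 that stops at the
-- legal position Γ is won by 𝒳, and whether a run is won depends only on the
-- position it stops at; so ⟨Γ⟩X = E(c⃗) is won by ⊤ when nobody moves, which
-- makes ‖E(c⃗)‖ true. Once 𝕃 is a false elementary sentence, the literal games
-- L and L ∨ 𝕃 coincide, and the replacement commutes with every connective.

module Submission where

open import Defs
open import Data.Nat using (ℕ; zero; suc; _+_; _*_; _∸_; _≤_; _<_; _≡ᵇ_; _<ᵇ_; z≤n; s≤s)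
open import Data.Nat.Properties
  using (≡⇒≡ᵇ; <⇒<ᵇ; ≤-refl; ≤-trans; n≤1+n; m≤m+n; m≤n+m; +-comm; +-suc; +-identityʳ;
         m+[n∸m]≡n; m<1+n⇒m<n∨m≡n; <-≤-connex; <⇒≱)
open import Data.Bool using (true; false; T)
open import Data.Bool.Properties using (T-≡)
open import Data.List using (List; []; _∷_; _++_)
open import Data.List.Properties
  using (++-assoc; ++-identityʳ; ++-identityʳ-unique; ++-conicalˡ; ++-conicalʳ;
         ∷-injectiveˡ; ∷-injectiveʳ; mapMaybe-++)
open import Data.List.Relation.Unary.All using (All; _∷_)
open import Data.List.Relation.Unary.All.Properties using (++⁻ˡ)
open import Data.Maybe using (just; nothing)
open import Data.Product using (Σ; _×_; _,_; proj₁; proj₂)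
open import Data.Sum using (_⊎_; inj₁; inj₂)
open import Data.Empty using (⊥-elim)
open import Relation.Nullary using (¬_)
open import Relation.Binary.PropositionalEquality
open import Function.Bundles using (_⇔_; mk⇔; Equivalence)

proj-++ : ∀ i (Φ Ψ : Position) → proj i (Φ ++ Ψ) ≡ proj i Φ ++ proj i Ψ
proj-++ i = mapMaybe-++ _

proj-[]⇒[] : ∀ (Φ : Position) → All ParMove Φ → proj false Φ ≡ [] → proj true Φ ≡ [] → Φ ≡ []
proj-[]⇒[] [] _ _ _ = refl
proj-[]⇒[] (m ∷ Φ) (inj₁ _ ∷ _) p q with strip false (proj₂ m)
proj-[]⇒[] (m ∷ Φ) (inj₁ () ∷ _) p q | nothing
proj-[]⇒[] (m ∷ Φ) (inj₁ _ ∷ _) () q | just _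
proj-[]⇒[] (m ∷ Φ) (inj₂ _ ∷ _) p q with strip true (proj₂ m)
proj-[]⇒[] (m ∷ Φ) (inj₂ () ∷ _) p q | nothing
proj-[]⇒[] (m ∷ Φ) (inj₂ _ ∷ _) p () | just _

legal-[] : ∀ F ρ → LegalF F ρ []
legal-[] ⊤′ ρ = refl
legal-[] ⊥′ ρ = refl
legal-[] (t == u) ρ = refl
legal-[] (t =/= u) ρ = refl
legal-[] (A ∧′ B) ρ = All.[] , legal-[] A ρ , legal-[] B ρ
legal-[] (A ∨′ B) ρ = All.[] , legal-[] A ρ , legal-[] B ρ
legal-[] (A ⊓′ B) ρ = inj₁ refl
legal-[] (A ⊔′ B) ρ = inj₁ refl
legal-[] (∀′ x A) ρ = λ c → legal-[] A (upd ρ x c)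
legal-[] (∃′ x A) ρ = λ c → legal-[] A (upd ρ x c)
legal-[] (⊓∀ x A) ρ = inj₁ refl
legal-[] (⊔∃ x A) ρ = inj₁ refl

legal-++⁻ˡ : ∀ F ρ (Φ Ψ : Position) → LegalF F ρ (Φ ++ Ψ) → LegalF F ρ Φ
legal-++⁻ˡ ⊤′ ρ Φ Ψ l = ++-conicalˡ Φ Ψ l
legal-++⁻ˡ ⊥′ ρ Φ Ψ l = ++-conicalˡ Φ Ψ l
legal-++⁻ˡ (t == u) ρ Φ Ψ l = ++-conicalˡ Φ Ψ l
legal-++⁻ˡ (t =/= u) ρ Φ Ψ l = ++-conicalˡ Φ Ψ l
legal-++⁻ˡ (A ∧′ B) ρ Φ Ψ (par , la , lb) = ++⁻ˡ Φ par ,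
  legal-++⁻ˡ A ρ _ _ (subst (LegalF A ρ) (proj-++ false Φ Ψ) la) ,
  legal-++⁻ˡ B ρ _ _ (subst (LegalF B ρ) (proj-++ true Φ Ψ) lb)
legal-++⁻ˡ (A ∨′ B) ρ Φ Ψ (par , la , lb) = ++⁻ˡ Φ par ,
  legal-++⁻ˡ A ρ _ _ (subst (LegalF A ρ) (proj-++ false Φ Ψ) la) ,
  legal-++⁻ˡ B ρ _ _ (subst (LegalF B ρ) (proj-++ true Φ Ψ) lb)
legal-++⁻ˡ (A ⊓′ B) ρ [] Ψ l = inj₁ refl
legal-++⁻ˡ (A ⊓′ B) ρ (m ∷ Φ) Ψ (inj₂ (_ , inj₁ (refl , l))) = inj₂ (Φ , inj₁ (refl , legal-++⁻ˡ A ρ Φ Ψ l))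
legal-++⁻ˡ (A ⊓′ B) ρ (m ∷ Φ) Ψ (inj₂ (_ , inj₂ (refl , l))) = inj₂ (Φ , inj₂ (refl , legal-++⁻ˡ B ρ Φ Ψ l))
legal-++⁻ˡ (A ⊔′ B) ρ [] Ψ l = inj₁ refl
legal-++⁻ˡ (A ⊔′ B) ρ (m ∷ Φ) Ψ (inj₂ (_ , inj₁ (refl , l))) = inj₂ (Φ , inj₁ (refl , legal-++⁻ˡ A ρ Φ Ψ l))
legal-++⁻ˡ (A ⊔′ B) ρ (m ∷ Φ) Ψ (inj₂ (_ , inj₂ (refl , l))) = inj₂ (Φ , inj₂ (refl , legal-++⁻ˡ B ρ Φ Ψ l))
legal-++⁻ˡ (∀′ x A) ρ Φ Ψ l = λ c → legal-++⁻ˡ A (upd ρ x c) Φ Ψ (l c)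
legal-++⁻ˡ (∃′ x A) ρ Φ Ψ l = λ c → legal-++⁻ˡ A (upd ρ x c) Φ Ψ (l c)
legal-++⁻ˡ (⊓∀ x A) ρ [] Ψ l = inj₁ refl
legal-++⁻ˡ (⊓∀ x A) ρ (m ∷ Φ) Ψ (inj₂ (c , _ , refl , l)) = inj₂ (c , Φ , refl , legal-++⁻ˡ A (upd ρ x c) Φ Ψ l)
legal-++⁻ˡ (⊔∃ x A) ρ [] Ψ l = inj₁ refl
legal-++⁻ˡ (⊔∃ x A) ρ (m ∷ Φ) Ψ (inj₂ (c , _ , refl , l)) = inj₂ (c , Φ , refl , legal-++⁻ˡ A (upd ρ x c) Φ Ψ l)

_⊑_ : Position → Position → Set
Φ ⊑ Ψ = Σ Position λ Z → Ψ ≡ Φ ++ Z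

⊑-trans : ∀ {Φ Ψ Θ} → Φ ⊑ Ψ → Ψ ⊑ Θ → Φ ⊑ Θ
⊑-trans {Φ} (Z , refl) (Z′ , refl) = Z ++ Z′ , ++-assoc Φ Z Z′

⊑-reflexive : ∀ {Φ Ψ} → Φ ≡ Ψ → Φ ⊑ Ψ
⊑-reflexive {Φ} refl = [] , sym (++-identityʳ Φ)

legal-⊑ : ∀ F ρ {Φ Ψ} → Φ ⊑ Ψ → LegalF F ρ Ψ → LegalF F ρ Φ
legal-⊑ F ρ {Φ} (Z , refl) = legal-++⁻ˡ F ρ Φ Z

++∷-compare : ∀ (Ψ Ψ′ : Position) m m′ r r′ → Ψ ++ m ∷ r ≡ Ψ′ ++ m′ ∷ r′ →
  ((Ψ ++ m ∷ []) ⊑ Ψ′) ⊎ ((Ψ′ ++ m′ ∷ []) ⊑ Ψ) ⊎ (Ψ ≡ Ψ′ × m ≡ m′)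
++∷-compare [] [] m m′ r r′ refl = inj₂ (inj₂ (refl , refl))
++∷-compare [] (x ∷ Ψ′) m m′ r r′ refl = inj₁ (Ψ′ , refl)
++∷-compare (x ∷ Ψ) [] m m′ r r′ refl = inj₂ (inj₁ (Ψ , refl))
++∷-compare (x ∷ Ψ) (y ∷ Ψ′) m m′ r r′ eq with ∷-injectiveˡ eq | ++∷-compare Ψ Ψ′ m m′ r r′ (∷-injectiveʳ eq)
... | refl | inj₁ (Z , e) = inj₁ (Z , cong (x ∷_) e)
... | refl | inj₂ (inj₁ (Z , e)) = inj₂ (inj₁ (Z , cong (x ∷_) e))
... | refl | inj₂ (inj₂ (e , m≡m′)) = inj₂ (inj₂ (cong (x ∷_) e , m≡m′))

illegal-⊑-legal : ∀ F ρ {p Φ Ψ} → Φ ⊑ Ψ → IllegalBy p (⟦ F ⟧ ρ) Φ → ¬ LegalF F ρ Ψ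
illegal-⊑-legal F ρ Φ⊑Ψ (Ψ₀ , m , rest , refl , _ , ¬lΨ₀m , _) lΨ =
  ¬lΨ₀m (legal-⊑ F ρ (⊑-trans (rest , sym (++-assoc Ψ₀ (m ∷ []) rest)) Φ⊑Ψ) lΨ)

illegalBy-unique : ∀ F ρ {p q Φ Φ′ Θ} → Φ ⊑ Θ → Φ′ ⊑ Θ →
  IllegalBy p (⟦ F ⟧ ρ) Φ → IllegalBy q (⟦ F ⟧ ρ) Φ′ → p ≡ q
illegalBy-unique F ρ (Z , refl) (Z′ , eq)
  (Ψ , m , r , refl , lΨ , ¬lΨm , refl) (Ψ′ , m′ , r′ , refl , lΨ′ , ¬lΨ′m′ , refl)
  with ++∷-compare Ψ Ψ′ m m′ (r ++ Z) (r′ ++ Z′)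
         (trans (sym (++-assoc Ψ (m ∷ r) Z)) (trans eq (++-assoc Ψ′ (m′ ∷ r′) Z′)))
... | inj₁ Ψm⊑Ψ′ = ⊥-elim (¬lΨm (legal-⊑ F ρ Ψm⊑Ψ′ lΨ′))
... | inj₂ (inj₁ Ψ′m′⊑Ψ) = ⊥-elim (¬lΨ′m′ (legal-⊑ F ρ Ψ′m′⊑Ψ lΨ))
... | inj₂ (inj₂ (_ , refl)) = refl

elementary-legal⇒[] : ∀ F ρ Φ → Elementary F → LegalF F ρ Φ → Φ ≡ []
elementary-legal⇒[] ⊤′ ρ Φ _ l = l
elementary-legal⇒[] ⊥′ ρ Φ _ l = l
elementary-legal⇒[] (t == u) ρ Φ _ l = l
elementary-legal⇒[] (t =/= u) ρ Φ _ l = l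
elementary-legal⇒[] (A ∧′ B) ρ Φ (eA , eB) (par , la , lb) =
  proj-[]⇒[] Φ par (elementary-legal⇒[] A ρ _ eA la) (elementary-legal⇒[] B ρ _ eB lb)
elementary-legal⇒[] (A ∨′ B) ρ Φ (eA , eB) (par , la , lb) =
  proj-[]⇒[] Φ par (elementary-legal⇒[] A ρ _ eA la) (elementary-legal⇒[] B ρ _ eB lb)
elementary-legal⇒[] (∀′ x A) ρ Φ e l = elementary-legal⇒[] A (upd ρ x 0) Φ e (l 0)
elementary-legal⇒[] (∃′ x A) ρ Φ e l = elementary-legal⇒[] A (upd ρ x 0) Φ e (l 0)

elementary-win⇒truth : ∀ F ρ Γ → Elementary F → WinF F ρ Γ → Truth F ρ
elementary-win⇒truth ⊤′ ρ Γ _ w = w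
elementary-win⇒truth ⊥′ ρ Γ _ w = w
elementary-win⇒truth (t == u) ρ Γ _ w = w
elementary-win⇒truth (t =/= u) ρ Γ _ w = w
elementary-win⇒truth (A ∧′ B) ρ Γ (eA , eB) (wa , wb) =
  elementary-win⇒truth A ρ _ eA wa , elementary-win⇒truth B ρ _ eB wb
elementary-win⇒truth (A ∨′ B) ρ Γ (eA , _) (inj₁ w) = inj₁ (elementary-win⇒truth A ρ _ eA w)
elementary-win⇒truth (A ∨′ B) ρ Γ (_ , eB) (inj₂ w) = inj₂ (elementary-win⇒truth B ρ _ eB w)
elementary-win⇒truth (∀′ x A) ρ Γ e w = λ c → elementary-win⇒truth A _ Γ e (w c)
elementary-win⇒truth (∃′ x A) ρ Γ e (c , w) = c , elementary-win⇒truth A _ Γ e w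

win-empty⇒elem-truth : ∀ F ρ Γ → EmptyRun Γ → WinF F ρ Γ → Truth (elem F) ρ
win-empty⇒elem-truth ⊤′ ρ Γ _ w = w
win-empty⇒elem-truth ⊥′ ρ Γ _ w = w
win-empty⇒elem-truth (t == u) ρ Γ _ w = w
win-empty⇒elem-truth (t =/= u) ρ Γ _ w = w
win-empty⇒elem-truth (A ∧′ B) ρ Γ emp (wa , wb) =
  win-empty⇒elem-truth A ρ _ (λ t → cong (proj false) (emp t)) wa ,
  win-empty⇒elem-truth B ρ _ (λ t → cong (proj true) (emp t)) wb
win-empty⇒elem-truth (A ∨′ B) ρ Γ emp (inj₁ w) = inj₁ (win-empty⇒elem-truth A ρ _ (λ t → cong (proj false) (emp t)) w)
win-empty⇒elem-truth (A ∨′ B) ρ Γ emp (inj₂ w) = inj₂ (win-empty⇒elem-truth B ρ _ (λ t → cong (proj true) (emp t)) w)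
win-empty⇒elem-truth (A ⊓′ B) ρ Γ _ _ = _
win-empty⇒elem-truth (A ⊔′ B) ρ Γ emp (t , _ , inj₁ ((_ , at) , _)) with trans (sym (emp t)) at
... | ()
win-empty⇒elem-truth (A ⊔′ B) ρ Γ emp (t , _ , inj₂ ((_ , at) , _)) with trans (sym (emp t)) at
... | ()
win-empty⇒elem-truth (∀′ x A) ρ Γ emp w = λ c → win-empty⇒elem-truth A (upd ρ x c) Γ emp (w c)
win-empty⇒elem-truth (∃′ x A) ρ Γ emp (c , w) = c , win-empty⇒elem-truth A (upd ρ x c) Γ emp w
win-empty⇒elem-truth (⊓∀ x A) ρ Γ _ _ = _
win-empty⇒elem-truth (⊔∃ x A) ρ Γ emp (_ , t , _ , (_ , at) , _) with trans (sym (emp t)) at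
... | ()

evalT-cong : ∀ t ρ ρ′ → (∀ y → OccT y t → ρ y ≡ ρ′ y) → evalT t ρ ≡ evalT t ρ′
evalT-cong (v x) ρ ρ′ h = h x refl
evalT-cong 𝟎 ρ ρ′ h = refl
evalT-cong (S t) ρ ρ′ h = cong suc (evalT-cong t ρ ρ′ h)
evalT-cong (t ⊕ u) ρ ρ′ h =
  cong₂ _+_ (evalT-cong t ρ ρ′ (λ y o → h y (inj₁ o))) (evalT-cong u ρ ρ′ (λ y o → h y (inj₂ o)))
evalT-cong (t ⊗ u) ρ ρ′ h =
  cong₂ _*_ (evalT-cong t ρ ρ′ (λ y o → h y (inj₁ o))) (evalT-cong u ρ ρ′ (λ y o → h y (inj₂ o)))

upd-agree : ∀ {ρ ρ′} (P : Var → Set) x c → (∀ y → y ≢ x × P y → ρ y ≡ ρ′ y) →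
  ∀ y → P y → upd ρ x c y ≡ upd ρ′ x c y
upd-agree P x c h y Py with y ≡ᵇ x in eq
... | true = refl
... | false = h y ((λ y≡x → subst T eq (≡⇒≡ᵇ y x y≡x)) , Py)

truth-cong : ∀ F ρ ρ′ → (∀ y → FreeIn y F → ρ y ≡ ρ′ y) → Truth F ρ → Truth F ρ′
truth-cong ⊤′ ρ ρ′ h w = w
truth-cong ⊥′ ρ ρ′ h w = w
truth-cong (t == u) ρ ρ′ h w =
  trans (sym (evalT-cong t ρ ρ′ (λ y o → h y (inj₁ o)))) (trans w (evalT-cong u ρ ρ′ (λ y o → h y (inj₂ o))))
truth-cong (t =/= u) ρ ρ′ h w eq =
  w (trans (evalT-cong t ρ ρ′ (λ y o → h y (inj₁ o))) (trans eq (sym (evalT-cong u ρ ρ′ (λ y o → h y (inj₂ o))))))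
truth-cong (A ∧′ B) ρ ρ′ h (wa , wb) =
  truth-cong A ρ ρ′ (λ y o → h y (inj₁ o)) wa , truth-cong B ρ ρ′ (λ y o → h y (inj₂ o)) wb
truth-cong (A ∨′ B) ρ ρ′ h (inj₁ w) = inj₁ (truth-cong A ρ ρ′ (λ y o → h y (inj₁ o)) w)
truth-cong (A ∨′ B) ρ ρ′ h (inj₂ w) = inj₂ (truth-cong B ρ ρ′ (λ y o → h y (inj₂ o)) w)
truth-cong (A ⊓′ B) ρ ρ′ h w = w
truth-cong (A ⊔′ B) ρ ρ′ h w = w
truth-cong (∀′ x A) ρ ρ′ h w = λ c → truth-cong A _ _ (upd-agree (λ y → FreeIn y A) x c h) (w c)
truth-cong (∃′ x A) ρ ρ′ h (c , w) = c , truth-cong A _ _ (upd-agree (λ y → FreeIn y A) x c h) w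
truth-cong (⊓∀ x A) ρ ρ′ h w = w
truth-cong (⊔∃ x A) ρ ρ′ h w = w

module _ (𝕃 : Formula) (𝕃-elementary : Elementary 𝕃) (𝕃-false : ∀ ρ → ¬ Truth 𝕃 ρ) where

  private
    literal-legal⁺ : ∀ L ρ (Φ : Position) → Φ ≡ [] → LegalF L ρ [] → LegalF (L ∨′ 𝕃) ρ Φ
    literal-legal⁺ L ρ .[] refl l = All.[] , l , legal-[] 𝕃 ρ

    literal-legal⁻ : ∀ ρ (Φ : Position) → All ParMove Φ → proj false Φ ≡ [] → LegalF 𝕃 ρ (proj true Φ) → Φ ≡ []
    literal-legal⁻ ρ Φ par p l = proj-[]⇒[] Φ par p (elementary-legal⇒[] 𝕃 ρ _ 𝕃-elementary l)

    literal-win⁻ : ∀ ρ Γ {P : Set} → P ⊎ WinF 𝕃 ρ Γ → P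
    literal-win⁻ ρ Γ (inj₁ p) = p
    literal-win⁻ ρ Γ (inj₂ w) = ⊥-elim (𝕃-false ρ (elementary-win⇒truth 𝕃 ρ Γ 𝕃-elementary w))

  bar-legal⁺ : ∀ E ρ Φ → LegalF E ρ Φ → LegalF (bar 𝕃 E) ρ Φ
  bar-legal⁺ ⊤′ ρ Φ l = literal-legal⁺ ⊤′ ρ Φ l refl
  bar-legal⁺ ⊥′ ρ Φ l = literal-legal⁺ ⊥′ ρ Φ l refl
  bar-legal⁺ (t == u) ρ Φ l = literal-legal⁺ (t == u) ρ Φ l refl
  bar-legal⁺ (t =/= u) ρ Φ l = literal-legal⁺ (t =/= u) ρ Φ l refl
  bar-legal⁺ (A ∧′ B) ρ Φ (par , la , lb) = par , bar-legal⁺ A ρ _ la , bar-legal⁺ B ρ _ lb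
  bar-legal⁺ (A ∨′ B) ρ Φ (par , la , lb) = par , bar-legal⁺ A ρ _ la , bar-legal⁺ B ρ _ lb
  bar-legal⁺ (A ⊓′ B) ρ Φ (inj₁ e) = inj₁ e
  bar-legal⁺ (A ⊓′ B) ρ Φ (inj₂ (Ψ , inj₁ (e , l))) = inj₂ (Ψ , inj₁ (e , bar-legal⁺ A ρ Ψ l))
  bar-legal⁺ (A ⊓′ B) ρ Φ (inj₂ (Ψ , inj₂ (e , l))) = inj₂ (Ψ , inj₂ (e , bar-legal⁺ B ρ Ψ l))
  bar-legal⁺ (A ⊔′ B) ρ Φ (inj₁ e) = inj₁ e
  bar-legal⁺ (A ⊔′ B) ρ Φ (inj₂ (Ψ , inj₁ (e , l))) = inj₂ (Ψ , inj₁ (e , bar-legal⁺ A ρ Ψ l))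
  bar-legal⁺ (A ⊔′ B) ρ Φ (inj₂ (Ψ , inj₂ (e , l))) = inj₂ (Ψ , inj₂ (e , bar-legal⁺ B ρ Ψ l))
  bar-legal⁺ (∀′ x A) ρ Φ l = λ c → bar-legal⁺ A (upd ρ x c) Φ (l c)
  bar-legal⁺ (∃′ x A) ρ Φ l = λ c → bar-legal⁺ A (upd ρ x c) Φ (l c)
  bar-legal⁺ (⊓∀ x A) ρ Φ (inj₁ e) = inj₁ e
  bar-legal⁺ (⊓∀ x A) ρ Φ (inj₂ (c , Ψ , e , l)) = inj₂ (c , Ψ , e , bar-legal⁺ A (upd ρ x c) Ψ l)
  bar-legal⁺ (⊔∃ x A) ρ Φ (inj₁ e) = inj₁ e
  bar-legal⁺ (⊔∃ x A) ρ Φ (inj₂ (c , Ψ , e , l)) = inj₂ (c , Ψ , e , bar-legal⁺ A (upd ρ x c) Ψ l)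

  bar-legal⁻ : ∀ E ρ Φ → LegalF (bar 𝕃 E) ρ Φ → LegalF E ρ Φ
  bar-legal⁻ ⊤′ ρ Φ (par , p , l) = literal-legal⁻ ρ Φ par p l
  bar-legal⁻ ⊥′ ρ Φ (par , p , l) = literal-legal⁻ ρ Φ par p l
  bar-legal⁻ (t == u) ρ Φ (par , p , l) = literal-legal⁻ ρ Φ par p l
  bar-legal⁻ (t =/= u) ρ Φ (par , p , l) = literal-legal⁻ ρ Φ par p l
  bar-legal⁻ (A ∧′ B) ρ Φ (par , la , lb) = par , bar-legal⁻ A ρ _ la , bar-legal⁻ B ρ _ lb
  bar-legal⁻ (A ∨′ B) ρ Φ (par , la , lb) = par , bar-legal⁻ A ρ _ la , bar-legal⁻ B ρ _ lb
  bar-legal⁻ (A ⊓′ B) ρ Φ (inj₁ e) = inj₁ e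
  bar-legal⁻ (A ⊓′ B) ρ Φ (inj₂ (Ψ , inj₁ (e , l))) = inj₂ (Ψ , inj₁ (e , bar-legal⁻ A ρ Ψ l))
  bar-legal⁻ (A ⊓′ B) ρ Φ (inj₂ (Ψ , inj₂ (e , l))) = inj₂ (Ψ , inj₂ (e , bar-legal⁻ B ρ Ψ l))
  bar-legal⁻ (A ⊔′ B) ρ Φ (inj₁ e) = inj₁ e
  bar-legal⁻ (A ⊔′ B) ρ Φ (inj₂ (Ψ , inj₁ (e , l))) = inj₂ (Ψ , inj₁ (e , bar-legal⁻ A ρ Ψ l))
  bar-legal⁻ (A ⊔′ B) ρ Φ (inj₂ (Ψ , inj₂ (e , l))) = inj₂ (Ψ , inj₂ (e , bar-legal⁻ B ρ Ψ l))
  bar-legal⁻ (∀′ x A) ρ Φ l = λ c → bar-legal⁻ A (upd ρ x c) Φ (l c)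
  bar-legal⁻ (∃′ x A) ρ Φ l = λ c → bar-legal⁻ A (upd ρ x c) Φ (l c)
  bar-legal⁻ (⊓∀ x A) ρ Φ (inj₁ e) = inj₁ e
  bar-legal⁻ (⊓∀ x A) ρ Φ (inj₂ (c , Ψ , e , l)) = inj₂ (c , Ψ , e , bar-legal⁻ A (upd ρ x c) Ψ l)
  bar-legal⁻ (⊔∃ x A) ρ Φ (inj₁ e) = inj₁ e
  bar-legal⁻ (⊔∃ x A) ρ Φ (inj₂ (c , Ψ , e , l)) = inj₂ (c , Ψ , e , bar-legal⁻ A (upd ρ x c) Ψ l)

  bar-win⁺ : ∀ E ρ Γ → WinF E ρ Γ → WinF (bar 𝕃 E) ρ Γ
  bar-win⁺ ⊤′ ρ Γ w = inj₁ w
  bar-win⁺ ⊥′ ρ Γ w = inj₁ w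
  bar-win⁺ (t == u) ρ Γ w = inj₁ w
  bar-win⁺ (t =/= u) ρ Γ w = inj₁ w
  bar-win⁺ (A ∧′ B) ρ Γ (wa , wb) = bar-win⁺ A ρ _ wa , bar-win⁺ B ρ _ wb
  bar-win⁺ (A ∨′ B) ρ Γ (inj₁ w) = inj₁ (bar-win⁺ A ρ _ w)
  bar-win⁺ (A ∨′ B) ρ Γ (inj₂ w) = inj₂ (bar-win⁺ B ρ _ w)
  bar-win⁺ (A ⊓′ B) ρ Γ (inj₁ e) = inj₁ e
  bar-win⁺ (A ⊓′ B) ρ Γ (inj₂ (t , r , inj₁ (f , w))) = inj₂ (t , r , inj₁ (f , bar-win⁺ A ρ _ w))
  bar-win⁺ (A ⊓′ B) ρ Γ (inj₂ (t , r , inj₂ (f , w))) = inj₂ (t , r , inj₂ (f , bar-win⁺ B ρ _ w))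
  bar-win⁺ (A ⊔′ B) ρ Γ (t , r , inj₁ (f , w)) = t , r , inj₁ (f , bar-win⁺ A ρ _ w)
  bar-win⁺ (A ⊔′ B) ρ Γ (t , r , inj₂ (f , w)) = t , r , inj₂ (f , bar-win⁺ B ρ _ w)
  bar-win⁺ (∀′ x A) ρ Γ w = λ c → bar-win⁺ A (upd ρ x c) Γ (w c)
  bar-win⁺ (∃′ x A) ρ Γ (c , w) = c , bar-win⁺ A (upd ρ x c) Γ w
  bar-win⁺ (⊓∀ x A) ρ Γ (inj₁ e) = inj₁ e
  bar-win⁺ (⊓∀ x A) ρ Γ (inj₂ (c , t , r , f , w)) = inj₂ (c , t , r , f , bar-win⁺ A (upd ρ x c) _ w)
  bar-win⁺ (⊔∃ x A) ρ Γ (c , t , r , f , w) = c , t , r , f , bar-win⁺ A (upd ρ x c) _ w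

  bar-win⁻ : ∀ E ρ Γ → WinF (bar 𝕃 E) ρ Γ → WinF E ρ Γ
  bar-win⁻ ⊤′ ρ Γ w = literal-win⁻ ρ _ w
  bar-win⁻ ⊥′ ρ Γ w = literal-win⁻ ρ _ w
  bar-win⁻ (t == u) ρ Γ w = literal-win⁻ ρ _ w
  bar-win⁻ (t =/= u) ρ Γ w = literal-win⁻ ρ _ w
  bar-win⁻ (A ∧′ B) ρ Γ (wa , wb) = bar-win⁻ A ρ _ wa , bar-win⁻ B ρ _ wb
  bar-win⁻ (A ∨′ B) ρ Γ (inj₁ w) = inj₁ (bar-win⁻ A ρ _ w)
  bar-win⁻ (A ∨′ B) ρ Γ (inj₂ w) = inj₂ (bar-win⁻ B ρ _ w)
  bar-win⁻ (A ⊓′ B) ρ Γ (inj₁ e) = inj₁ e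
  bar-win⁻ (A ⊓′ B) ρ Γ (inj₂ (t , r , inj₁ (f , w))) = inj₂ (t , r , inj₁ (f , bar-win⁻ A ρ _ w))
  bar-win⁻ (A ⊓′ B) ρ Γ (inj₂ (t , r , inj₂ (f , w))) = inj₂ (t , r , inj₂ (f , bar-win⁻ B ρ _ w))
  bar-win⁻ (A ⊔′ B) ρ Γ (t , r , inj₁ (f , w)) = t , r , inj₁ (f , bar-win⁻ A ρ _ w)
  bar-win⁻ (A ⊔′ B) ρ Γ (t , r , inj₂ (f , w)) = t , r , inj₂ (f , bar-win⁻ B ρ _ w)
  bar-win⁻ (∀′ x A) ρ Γ w = λ c → bar-win⁻ A (upd ρ x c) Γ (w c)
  bar-win⁻ (∃′ x A) ρ Γ (c , w) = c , bar-win⁻ A (upd ρ x c) Γ w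
  bar-win⁻ (⊓∀ x A) ρ Γ (inj₁ e) = inj₁ e
  bar-win⁻ (⊓∀ x A) ρ Γ (inj₂ (c , t , r , f , w)) = inj₂ (c , t , r , f , bar-win⁻ A (upd ρ x c) _ w)
  bar-win⁻ (⊔∃ x A) ρ Γ (c , t , r , f , w) = c , t , r , f , bar-win⁻ A (upd ρ x c) _ w

  bar-gameEq : ∀ E ρ → GameEq (⟦ E ⟧ ρ) (⟦ bar 𝕃 E ⟧ ρ)
  bar-gameEq E ρ = (λ Φ → mk⇔ (bar-legal⁺ E ρ Φ) (bar-legal⁻ E ρ Φ))
                 , (λ Γ _ → mk⇔ (bar-win⁺ E ρ Γ) (bar-win⁻ E ρ Γ))

pre-cong : ∀ Γ Δ k → (∀ s → s < k → Γ s ≡ Δ s) → pre Γ k ≡ pre Δ k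
pre-cong Γ Δ zero h = refl
pre-cong Γ Δ (suc k) h = cong₂ _++_ (pre-cong Γ Δ k (λ s p → h s (≤-trans p (n≤1+n k)))) (h k ≤-refl)

pre-empty : ∀ Γ k → (∀ s → s < k → Γ s ≡ []) → pre Γ k ≡ []
pre-empty Γ zero h = refl
pre-empty Γ (suc k) h rewrite pre-empty Γ k (λ s p → h s (≤-trans p (n≤1+n k))) = h k ≤-refl

pre-[]⇒empty : ∀ Γ k → pre Γ k ≡ [] → ∀ s → s < k → Γ s ≡ []
pre-[]⇒empty Γ (suc k) e s p with m<1+n⇒m<n∨m≡n p
... | inj₁ s<k = pre-[]⇒empty Γ k (++-conicalˡ _ _ e) s s<k
... | inj₂ refl = ++-conicalʳ _ _ e

segment : Run → ℕ → ℕ → Position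
segment Γ a k = pre (λ s → Γ (a + s)) k

pre-+ : ∀ Γ a k → pre Γ (a + k) ≡ pre Γ a ++ segment Γ a k
pre-+ Γ a zero rewrite +-identityʳ a = sym (++-identityʳ _)
pre-+ Γ a (suc k) rewrite +-suc a k | pre-+ Γ a k = ++-assoc (pre Γ a) _ _

pre-mono : ∀ Γ {a b} → a ≤ b → pre Γ a ⊑ pre Γ b
pre-mono Γ {a} {b} a≤b =
  segment Γ a (b ∸ a) , trans (cong (pre Γ) (sym (m+[n∸m]≡n a≤b))) (pre-+ Γ a (b ∸ a))

pre-projR : ∀ i Γ k → pre (projR i Γ) k ≡ proj i (pre Γ k)
pre-projR i Γ zero = refl
pre-projR i Γ (suc k) rewrite pre-projR i Γ k = sym (proj-++ i (pre Γ k) (Γ k))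

Settles : Run → Position → Set
Settles Γ Φ = Σ ℕ λ T → ((t : ℕ) → T ≤ t → Γ t ≡ []) × pre Γ T ≡ Φ

settles-pre : ∀ Γ Φ → (s : Settles Γ Φ) → ∀ k → pre Γ (proj₁ s + k) ≡ Φ
settles-pre Γ Φ (T , silent , p) k rewrite pre-+ Γ T k
  | pre-empty (λ s → Γ (T + s)) k (λ s _ → silent (T + s) (m≤m+n T s)) = trans (++-identityʳ _) p

settles-projR : ∀ i Γ Φ → Settles Γ Φ → Settles (projR i Γ) (proj i Φ)
settles-projR i Γ Φ (T , silent , p) =
  T , (λ t q → cong (proj i) (silent t q)) , trans (pre-projR i Γ T) (cong (proj i) p)

settles-[]⇒empty : ∀ Γ → Settles Γ [] → EmptyRun Γ
settles-[]⇒empty Γ (T , silent , p) t with <-≤-connex t T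
... | inj₁ t<T = pre-[]⇒empty Γ T p t t<T
... | inj₂ T≤t = silent t T≤t

empty-settles⇒[] : ∀ Γ Φ → EmptyRun Γ → Settles Γ Φ → Φ ≡ []
empty-settles⇒[] Γ Φ emp (T , _ , p) = trans (sym p) (pre-empty Γ T (λ s _ → emp s))

settles-⊹-empty : ∀ Φ → Settles (Φ ⊹ (λ _ → [])) Φ
settles-⊹-empty Φ = 1 , (λ { (suc t) _ → refl }) , ++-identityʳ Φ

private
  ≤⇒<ᵇ≡false : ∀ {m n} → n ≤ m → (m <ᵇ n) ≡ false
  ≤⇒<ᵇ≡false z≤n = refl
  ≤⇒<ᵇ≡false (s≤s n≤m) = ≤⇒<ᵇ≡false n≤m

  >⇒≡ᵇ≡false : ∀ {m n} → n < m → (m ≡ᵇ n) ≡ false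
  >⇒≡ᵇ≡false {suc m} {zero} _ = refl
  >⇒≡ᵇ≡false {suc m} {suc n} (s≤s n<m) = >⇒≡ᵇ≡false n<m

after-< : ∀ Γ t rest s → s < t → after Γ t rest s ≡ []
after-< Γ t rest s s<t rewrite Equivalence.to T-≡ (<⇒<ᵇ s<t) = refl

after-≡ : ∀ Γ t rest → after Γ t rest t ≡ rest
after-≡ Γ t rest rewrite ≤⇒<ᵇ≡false (≤-refl {t}) | Equivalence.to T-≡ (≡⇒≡ᵇ t t refl) = refl

after-> : ∀ Γ t rest u → t < u → after Γ t rest u ≡ Γ u
after-> Γ t rest u t<u rewrite ≤⇒<ᵇ≡false (≤-trans (n≤1+n t) t<u) | >⇒≡ᵇ≡false t<u = refl

settles-after : ∀ Γ t m rest Φ → FirstAt Γ t m rest → Settles Γ Φ →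
  Σ Position λ Φ′ → Φ ≡ m ∷ Φ′ × Settles (after Γ t rest) Φ′
settles-after Γ t m rest Φ (before , at) s@(T , silent , _) =
  rest ++ segment Γ (suc t) T , Φ≡ , suc t + T , silent-after , pre-after
  where
  pre-first : pre Γ (suc t) ≡ m ∷ rest
  pre-first rewrite pre-empty Γ t before = at
  Φ≡ : Φ ≡ m ∷ (rest ++ segment Γ (suc t) T)
  Φ≡ = begin
    Φ                                     ≡⟨ sym (settles-pre Γ Φ s (suc t)) ⟩
    pre Γ (T + suc t)                     ≡⟨ cong (pre Γ) (+-comm T (suc t)) ⟩
    pre Γ (suc t + T)                     ≡⟨ pre-+ Γ (suc t) T ⟩
    pre Γ (suc t) ++ segment Γ (suc t) T  ≡⟨ cong (_++ segment Γ (suc t) T) pre-first ⟩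
    m ∷ (rest ++ segment Γ (suc t) T)     ∎
    where open ≡-Reasoning
  silent-after : (u : ℕ) → suc t + T ≤ u → after Γ t rest u ≡ []
  silent-after u q = trans (after-> Γ t rest u (≤-trans (s≤s (m≤m+n t T)) q))
                           (silent u (≤-trans (m≤n+m T (suc t)) q))
  pre-after : pre (after Γ t rest) (suc t + T) ≡ rest ++ segment Γ (suc t) T
  pre-after rewrite pre-+ (after Γ t rest) (suc t) T
    | pre-empty (after Γ t rest) t (after-< Γ t rest) | after-≡ Γ t rest =
    cong (rest ++_) (pre-cong _ _ T (λ s _ → after-> Γ t rest (suc t + s) (s≤s (m≤m+n t s))))

first-nonempty-chunk : ∀ (Γ : Run) n → (∀ s → s < n → Γ s ≡ []) ⊎
  (Σ ℕ λ t → Σ LMove λ m → Σ Position λ rest → FirstAt Γ t m rest)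
first-nonempty-chunk Γ zero = inj₁ (λ s ())
first-nonempty-chunk Γ (suc n) with first-nonempty-chunk Γ n
... | inj₂ first = inj₂ first
... | inj₁ before with Γ n in eq
...   | [] = inj₁ below-suc
  where
  below-suc : ∀ s → s < suc n → Γ s ≡ []
  below-suc s p with m<1+n⇒m<n∨m≡n p
  ... | inj₁ s<n = before s s<n
  ... | inj₂ refl = eq
...   | m ∷ rest = inj₂ (n , m , rest , before , eq)

settles-∷⇒firstAt : ∀ Γ m Φ′ → Settles Γ (m ∷ Φ′) →
  Σ ℕ λ t → Σ Position λ rest → FirstAt Γ t m rest × Settles (after Γ t rest) Φ′
settles-∷⇒firstAt Γ m Φ′ s@(T , _ , p) with first-nonempty-chunk Γ T
... | inj₁ before with trans (sym (pre-empty Γ T before)) p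
...   | ()
settles-∷⇒firstAt Γ m Φ′ s | inj₂ (t , m′ , rest , first) with settles-after Γ t m′ rest (m ∷ Φ′) first s
... | _ , refl , s′ = t , rest , first , s′

firstAt-transfer : ∀ Γ Δ t {m} rest Φ → FirstAt Γ t m rest → Settles Γ Φ → Settles Δ Φ →
  Σ ℕ λ t′ → Σ Position λ rest′ → FirstAt Δ t′ m rest′ ×
  Σ Position λ Φ′ → Settles (after Γ t rest) Φ′ × Settles (after Δ t′ rest′) Φ′
firstAt-transfer Γ Δ t rest Φ f sΓ sΔ with settles-after Γ t _ rest Φ f sΓ
... | Φ′ , refl , s with settles-∷⇒firstAt Δ _ Φ′ sΔ
... | t′ , rest′ , f′ , s′ = t′ , rest′ , f′ , Φ′ , s , s′

win-settles : ∀ F ρ Γ Δ Φ → Settles Γ Φ → Settles Δ Φ → WinF F ρ Γ → WinF F ρ Δ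
win-settles ⊤′ ρ Γ Δ Φ _ _ w = w
win-settles ⊥′ ρ Γ Δ Φ _ _ w = w
win-settles (t == u) ρ Γ Δ Φ _ _ w = w
win-settles (t =/= u) ρ Γ Δ Φ _ _ w = w
win-settles (A ∧′ B) ρ Γ Δ Φ sΓ sΔ (wa , wb) =
  win-settles A ρ _ _ _ (settles-projR false Γ Φ sΓ) (settles-projR false Δ Φ sΔ) wa ,
  win-settles B ρ _ _ _ (settles-projR true Γ Φ sΓ) (settles-projR true Δ Φ sΔ) wb
win-settles (A ∨′ B) ρ Γ Δ Φ sΓ sΔ (inj₁ w) =
  inj₁ (win-settles A ρ _ _ _ (settles-projR false Γ Φ sΓ) (settles-projR false Δ Φ sΔ) w)
win-settles (A ∨′ B) ρ Γ Δ Φ sΓ sΔ (inj₂ w) =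
  inj₂ (win-settles B ρ _ _ _ (settles-projR true Γ Φ sΓ) (settles-projR true Δ Φ sΔ) w)
win-settles (A ⊓′ B) ρ Γ Δ Φ sΓ sΔ (inj₁ emp) with empty-settles⇒[] Γ Φ emp sΓ
... | refl = inj₁ (settles-[]⇒empty Δ sΔ)
win-settles (A ⊓′ B) ρ Γ Δ Φ sΓ sΔ (inj₂ (t , rest , inj₁ (f , w))) with firstAt-transfer Γ Δ t rest Φ f sΓ sΔ
... | t′ , rest′ , f′ , Φ′ , s , s′ = inj₂ (t′ , rest′ , inj₁ (f′ , win-settles A ρ _ _ Φ′ s s′ w))
win-settles (A ⊓′ B) ρ Γ Δ Φ sΓ sΔ (inj₂ (t , rest , inj₂ (f , w))) with firstAt-transfer Γ Δ t rest Φ f sΓ sΔ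
... | t′ , rest′ , f′ , Φ′ , s , s′ = inj₂ (t′ , rest′ , inj₂ (f′ , win-settles B ρ _ _ Φ′ s s′ w))
win-settles (A ⊔′ B) ρ Γ Δ Φ sΓ sΔ (t , rest , inj₁ (f , w)) with firstAt-transfer Γ Δ t rest Φ f sΓ sΔ
... | t′ , rest′ , f′ , Φ′ , s , s′ = t′ , rest′ , inj₁ (f′ , win-settles A ρ _ _ Φ′ s s′ w)
win-settles (A ⊔′ B) ρ Γ Δ Φ sΓ sΔ (t , rest , inj₂ (f , w)) with firstAt-transfer Γ Δ t rest Φ f sΓ sΔ
... | t′ , rest′ , f′ , Φ′ , s , s′ = t′ , rest′ , inj₂ (f′ , win-settles B ρ _ _ Φ′ s s′ w)
win-settles (∀′ x A) ρ Γ Δ Φ sΓ sΔ w = λ c → win-settles A (upd ρ x c) Γ Δ Φ sΓ sΔ (w c)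
win-settles (∃′ x A) ρ Γ Δ Φ sΓ sΔ (c , w) = c , win-settles A (upd ρ x c) Γ Δ Φ sΓ sΔ w
win-settles (⊓∀ x A) ρ Γ Δ Φ sΓ sΔ (inj₁ emp) with empty-settles⇒[] Γ Φ emp sΓ
... | refl = inj₁ (settles-[]⇒empty Δ sΔ)
win-settles (⊓∀ x A) ρ Γ Δ Φ sΓ sΔ (inj₂ (c , t , rest , f , w)) with firstAt-transfer Γ Δ t rest Φ f sΓ sΔ
... | t′ , rest′ , f′ , Φ′ , s , s′ = inj₂ (c , t′ , rest′ , f′ , win-settles A (upd ρ x c) _ _ Φ′ s s′ w)
win-settles (⊔∃ x A) ρ Γ Δ Φ sΓ sΔ (c , t , rest , f , w) with firstAt-transfer Γ Δ t rest Φ f sΓ sΔ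
... | t′ , rest′ , f′ , Φ′ , s , s′ = c , t′ , rest′ , f′ , win-settles A (upd ρ x c) _ _ Φ′ s s′ w

module _ (M : HPM) (e : Env) where

  history-suc : ∀ t → proj₂ (hist M e (suc t)) ≡ (proj₂ (hist M e t) ++ envCh e t) ++ topCh M (cfgAt M e t)
  history-suc t with hist M e t
  ... | C , H = refl

  history≡pre : ∀ t → proj₂ (hist M e t) ≡ pre (runOf M e) t
  history≡pre zero = refl
  history≡pre (suc t) rewrite history-suc t | history≡pre t = ++-assoc (pre (runOf M e) t) (envCh e t) _

  posAt≡pre++envCh : ∀ t → posAt M e t ≡ pre (runOf M e) t ++ envCh e t
  posAt≡pre++envCh t = cong (_++ envCh e t) (history≡pre t)

  posAt⊑pre-suc : ∀ t → posAt M e t ⊑ pre (runOf M e) (suc t)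
  posAt⊑pre-suc t rewrite posAt≡pre++envCh t =
    topCh M (cfgAt M e t) , sym (++-assoc (pre (runOf M e) t) (envCh e t) _)

  pre⊑posAt : ∀ t → pre (runOf M e) t ⊑ posAt M e t
  pre⊑posAt t rewrite posAt≡pre++envCh t = envCh e t , refl

  posAt-suc : ∀ t → posAt M e (suc t) ≡ posAt M e t ++ (topCh M (cfgAt M e t) ++ envCh e (suc t))
  posAt-suc t = begin
    posAt M e (suc t)                             ≡⟨ posAt≡pre++envCh (suc t) ⟩
    (Π ++ (envCh e t ++ τ)) ++ envCh e (suc t)     ≡⟨ cong (_++ envCh e (suc t)) (sym (++-assoc Π (envCh e t) τ)) ⟩
    ((Π ++ envCh e t) ++ τ) ++ envCh e (suc t)     ≡⟨ ++-assoc (Π ++ envCh e t) τ (envCh e (suc t)) ⟩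
    (Π ++ envCh e t) ++ (τ ++ envCh e (suc t))     ≡⟨ cong (_++ (τ ++ envCh e (suc t))) (sym (posAt≡pre++envCh t)) ⟩
    posAt M e t ++ (τ ++ envCh e (suc t))          ∎
    where
    open ≡-Reasoning
    Π = pre (runOf M e) t
    τ = topCh M (cfgAt M e t)

  posAt-stable⇒silent : ∀ t → posAt M e t ≡ posAt M e (suc t) →
    topCh M (cfgAt M e t) ≡ [] × envCh e (suc t) ≡ []
  posAt-stable⇒silent t eq = ++-conicalˡ _ _ nothing-new , ++-conicalʳ _ _ nothing-new
    where
    nothing-new : topCh M (cfgAt M e t) ++ envCh e (suc t) ≡ []
    nothing-new = ++-identityʳ-unique (posAt M e t) (trans eq (posAt-suc t))

  generated-settles : ∀ Γ T → (∀ t → T ≤ t → posAt M e t ≡ Γ) → Settles (runOf M e) Γ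
  generated-settles Γ T gen = suc T , silent , reached
    where
    quiet : ∀ u → T ≤ u → topCh M (cfgAt M e u) ≡ [] × envCh e (suc u) ≡ []
    quiet u q = posAt-stable⇒silent u (trans (gen u q) (sym (gen (suc u) (≤-trans q (n≤1+n u)))))
    silent : ∀ u → suc T ≤ u → runOf M e u ≡ []
    silent (suc u) (s≤s q) rewrite proj₂ (quiet u q) | proj₁ (quiet (suc u) (≤-trans q (n≤1+n u))) = refl
    reached : pre (runOf M e) (suc T) ≡ Γ
    reached rewrite proj₁ (quiet T ≤-refl) = begin
      pre (runOf M e) T ++ (envCh e T ++ [])  ≡⟨ cong (pre (runOf M e) T ++_) (++-identityʳ (envCh e T)) ⟩
      pre (runOf M e) T ++ envCh e T          ≡⟨ sym (posAt≡pre++envCh T) ⟩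
      posAt M e T                             ≡⟨ gen T ≤-refl ⟩
      Γ                                       ∎
      where open ≡-Reasoning

¬Cond2 : ∀ X {M χ} → RunsInTime M χ → ¬ Cond2 X M χ
¬Cond2 X runsIn (e , c , α , moves , slow) = <⇒≱ slow (proj₁ (runsIn e c α moves))

module _ (X : Formula) (𝒳 : HPM) (solves : Solves 𝒳 (⟦ X ⟧ ρ₀)) where

  ¬Cond1 : ¬ Cond1 X 𝒳
  ¬Cond1 (e , c , ill) with solves e
  ... | inj₁ (legal , _) = illegal-⊑-legal X ρ₀ (posAt⊑pre-suc 𝒳 e c) ill (legal (suc c))
  ... | inj₂ (t , ill′)
    with illegalBy-unique X ρ₀ (⊑-trans (posAt⊑pre-suc 𝒳 e c) (pre-mono _ (m≤m+n (suc c) t)))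
                               (pre-mono _ (m≤n+m t (suc c))) ill ill′
  ... | ()

  ¬Cond3 : ¬ Cond3 X 𝒳
  ¬Cond3 (Γ , legalΓ , (e , T , gen) , E , _ , σ , ⟨Γ⟩X≈E , ¬elem) with solves e
  ... | inj₂ (t , ill) = illegal-⊑-legal X ρ₀ reaches ill legalΓ
    where
    reaches : pre (runOf 𝒳 e) t ⊑ Γ
    reaches = ⊑-trans (pre-mono _ (m≤m+n t T))
                (⊑-trans (pre⊑posAt 𝒳 e (t + T)) (⊑-reflexive (gen (t + T) (m≤n+m T t))))
  ... | inj₁ (_ , won) = ¬elem (win-empty⇒elem-truth E σ (λ _ → []) (λ _ → refl) wonE)
    where
    wonX : WinF X ρ₀ (Γ ⊹ (λ _ → []))
    wonX = win-settles X ρ₀ (runOf 𝒳 e) _ Γ (generated-settles 𝒳 e Γ T gen) (settles-⊹-empty Γ) won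
    legal-silent : LegalRun (⟦ E ⟧ σ) (λ _ → [])
    legal-silent t = subst (LegalF E σ) (sym (pre-empty _ t (λ _ _ → refl))) (legal-[] E σ)
    wonE : WinF E σ (λ _ → [])
    wonE = Equivalence.to (proj₂ ⟨Γ⟩X≈E (λ _ → []) legal-silent) wonX

lemma14p2 : (X : Formula) → Sentence X →
    (𝒳 : HPM) → (χ : Term) → SingleVar χ → ((x : ℕ) → x ≤ evalχ χ x) →
    Solves 𝒳 (⟦ X ⟧ ρ₀) → RunsInTime 𝒳 (evalχ χ) →
    (𝕃 : Formula) → Elementary 𝕃 → Sentence 𝕃 →
    (Truth 𝕃 ρ₀ ⇔ (Cond1 X 𝒳 ⊎ Cond2 X 𝒳 (evalχ χ) ⊎ Cond3 X 𝒳)) →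
    (E : Formula) → SubUpToRenaming E X →
    (ρ : Val) → GameEq (⟦ E ⟧ ρ) (⟦ bar 𝕃 E ⟧ ρ)
lemma14p2 X _ 𝒳 χ _ _ solves runsIn 𝕃 𝕃-elementary 𝕃-sentence 𝕃⇔disjuncts E _ ρ =
  bar-gameEq 𝕃 𝕃-elementary 𝕃-false E ρ
  where
  𝕃-false : ∀ σ → ¬ Truth 𝕃 σ
  𝕃-false σ 𝕃-true with Equivalence.to 𝕃⇔disjuncts (truth-cong 𝕃 σ ρ₀ (λ y y∈𝕃 → ⊥-elim (𝕃-sentence y y∈𝕃)) 𝕃-true)
  ... | inj₁ cond1 = ¬Cond1 X 𝒳 solves cond1
  ... | inj₂ (inj₁ cond2) = ¬Cond2 X {χ = evalχ χ} runsIn cond2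
  ... | inj₂ (inj₂ cond3) = ¬Cond3 X 𝒳 solves cond3
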